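{- Let $n\ge 1$, let $f:\mathbb{Z}_n\to\mathbb{Z}_n$ be a function, and let $G$ be the digraph associated to $f$. Let $c:\mathbb{Z}_n\to\{1,\dots,t\}$ be an exact $t$-coloring that is rainbow-free for the equation $x-y=f(z)$, and let $D$ be a (weakly connected) component of $G$ such that $c(0)\notin c(D)$. Then $D$ is monochromatic.
   Context: The digraph associated to $f$ has vertex set $\mathbb{Z}_n$ and a directed edge $(a,b)$ if and only if $f(a)=b$. For a component $D$, $c(D)=\{c(a): a\in D\}$, and $D$ is monochromatic if $|c(D)|=1$. An exact $t$-coloring is a surjective map onto $\{1,\dots,t\}$. $c$ is rainbow-free for $x-y=f(z)$ if there is no triple $(a_1,a_2,a_3)\in\mathbb{Z}_n^3$ with $a_1-a_2=f(a_3)$ and $c(a_1),c(a_2),c(a_3)$ pairwise distinct. -}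

module Defs where

open import Data.Nat using (ℕ; suc; _+_; _%_)
open import Data.Fin using (Fin; toℕ)
open import Data.Sum using (_⊎_)
open import Data.Product using (Σ; ∃; _×_)
open import Relation.Binary.PropositionalEquality using (_≡_; _≢_)
open import Relation.Binary.Construct.Closure.ReflexiveTransitive using (Star)
open import Function.Definitions using (Surjective)
open import Relation.Unary using (Pred; _∈_)
open import Level using (0ℓ)
open import Relation.Nullary using (¬_)

-- ℤ_n is represented by Fin n, for n = suc m (so n ≥ 1).
-- a₁ - a₂ = b in ℤ_n  iff  (a₂ + b) mod n = a₁.
SubEq : (m : ℕ) → Fin (suc m) → Fin (suc m) → Fin (suc m) → Set
SubEq m a₁ a₂ b = (toℕ a₂ + toℕ b) % suc m ≡ toℕ a₁

Adj : ∀ {k} → (Fin k → Fin k) → Fin k → Fin k → Set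
Adj f a b = (f a ≡ b) ⊎ (f b ≡ a)

WConn : ∀ {k} → (Fin k → Fin k) → Fin k → Fin k → Set
WConn f = Star (Adj f)

IsComponent : ∀ {k} → (Fin k → Fin k) → Pred (Fin k) 0ℓ → Set
IsComponent f D =
  (∃ λ a → a ∈ D) ×
  ((∀ a b → a ∈ D → b ∈ D → WConn f a b) ×
   (∀ a b → a ∈ D → Adj f a b → b ∈ D))

ExactColoring : ∀ {k} (t : ℕ) → (Fin k → Fin t) → Set
ExactColoring t c = Surjective _≡_ _≡_ c

RainbowFree : ∀ (m : ℕ) {t} → (Fin (suc m) → Fin (suc m)) → (Fin (suc m) → Fin t) → Set
RainbowFree m f c = ∀ a₁ a₂ a₃ → SubEq m a₁ a₂ (f a₃) →
  ¬ (c a₁ ≢ c a₂ × (c a₁ ≢ c a₃ × c a₂ ≢ c a₃))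

Monochromatic : ∀ {k t} → (Fin k → Fin t) → Pred (Fin k) 0ℓ → Set
Monochromatic c D = ∀ a b → a ∈ D → b ∈ D → c a ≡ c b

{-# OPTIONS --safe #-}
module Submission where

-- For a in D the triple (f a, 0, a) solves x - y = f z.  Since c 0 is neither
-- c (f a) nor c a, rainbow-freeness forces c (f a) = c a: the colour does not
-- change along any edge of D, hence is constant on the connected set D.

open import Defs
open import Data.Nat using (ℕ; suc)
open import Data.Nat.DivMod using (m<n⇒m%n≡m)
open import Data.Fin using (Fin; zero; toℕ; _≟_)
open import Data.Fin.Properties using (toℕ<n)
open import Data.Sum using (inj₁; inj₂)
open import Data.Product using (_,_)
open import Level using (0ℓ)
open import Relation.Binary.Core using (Rel)
open import Relation.Binary.PropositionalEquality using (_≡_; _≢_; refl; sym; trans; cong)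
open import Relation.Binary.Construct.Closure.ReflexiveTransitive using (Star; ε; _◅_)
open import Relation.Nullary.Decidable using (decidable-stable)
open import Relation.Unary using (Pred; _∈_)

SubEq-zeroʳ : ∀ m (b : Fin (suc m)) → SubEq m b zero b
SubEq-zeroʳ m b = m<n⇒m%n≡m (toℕ<n b)

RainbowFree⇒colour-f≡ : ∀ m {t} (f : Fin (suc m) → Fin (suc m)) (c : Fin (suc m) → Fin t) →
  RainbowFree m f c → ∀ a → c a ≢ c zero → c (f a) ≢ c zero → c (f a) ≡ c a
RainbowFree⇒colour-f≡ m f c rf a ca≢c0 cfa≢c0 =
  decidable-stable (c (f a) ≟ c a) λ cfa≢ca →
    rf (f a) zero a (SubEq-zeroʳ m (f a)) (cfa≢c0 , cfa≢ca , λ c0≡ca → ca≢c0 (sym c0≡ca))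

Star-closed-invariant : ∀ {A B : Set} {R : Rel A 0ℓ} (P : Pred A 0ℓ) (g : A → B) →
  (∀ {a b} → a ∈ P → R a b → b ∈ P) →
  (∀ {a b} → a ∈ P → R a b → g a ≡ g b) →
  ∀ {a b} → a ∈ P → Star R a b → g a ≡ g b
Star-closed-invariant P g closed respects aP ε = refl
Star-closed-invariant P g closed respects aP (r ◅ rs) =
  trans (respects aP r) (Star-closed-invariant P g closed respects (closed aP r) rs)

mainTheorem19 : (m t : ℕ) (f : Fin (suc m) → Fin (suc m)) (c : Fin (suc m) → Fin t)
    → ExactColoring t c
    → RainbowFree m f c
    → (D : Pred (Fin (suc m)) 0ℓ)
    → IsComponent f D
    → (∀ a → a ∈ D → c a ≢ c zero)
    → Monochromatic c D
mainTheorem19 m t f c _ rf D (_ , connected , closed) avoids0 a b aD bD =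
  Star-closed-invariant D c closedAdj respectsAdj aD (connected a b aD bD)
  where
  closedAdj : ∀ {x y} → x ∈ D → Adj f x y → y ∈ D
  closedAdj {x} {y} = closed x y

  colour-f : ∀ x → x ∈ D → c (f x) ≡ c x
  colour-f x xD = RainbowFree⇒colour-f≡ m f c rf x (avoids0 x xD)
    (avoids0 (f x) (closed x (f x) xD (inj₁ refl)))

  respectsAdj : ∀ {x y} → x ∈ D → Adj f x y → c x ≡ c y
  respectsAdj xD (inj₁ refl) = sym (colour-f _ xD)
  respectsAdj xD (inj₂ refl) = colour-f _ (closed _ _ xD (inj₂ refl))
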